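{- Let $m=\prod_{i=1}^r p_i^{e_i}$ with $e_i\geq 1$ and pairwise distinct primes $p_i\geq 3$. Suppose there is no Wall-Sun-Sun prime, i.e. there is no prime $p$ with $p^2 \mid u_{\gamma(p)}$. Then $m^2\nmid u_{\gamma(m)}$.
   Context: $(u_n)_{n\ge 0}$ is the Fibonacci sequence ($u_0=0$, $u_1=1$, $u_n=u_{n-1}+u_{n-2}$). For an integer $m\ge1$, $\gamma(m)$ is the smallest positive $l$ with $u_l\equiv0$ and $u_{l+1}\equiv1\pmod m$. A prime $p$ is a Wall-Sun-Sun prime if $p^2\mid u_{\gamma(p)}$ (equivalently $p^2 \mid u_{p-(\frac{p}{5})}$ with the Legendre symbol $(\frac{p}{5})$). -}

module Defs where

open import Data.Nat using (ℕ; zero; suc; _+_; _*_; _<_)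
open import Data.Integer as ℤ using (ℤ; +_; _-_)
import Data.Integer.Divisibility as ℤD

u : ℕ → ℕ
u zero = 0
u (suc zero) = 1
u (suc (suc n)) = u (suc n) + u n

_≡_[mod_] : ℕ → ℕ → ℕ → Set
a ≡ b [mod m ] = (+ m) ℤD.∣ ((+ a) - (+ b))

IsPeriodIndex : ℕ → ℕ → Set
IsPeriodIndex m l = 0 < l × (u l ≡ 0 [mod m ]) × (u (suc l) ≡ 1 [mod m ])
  where open import Data.Product using (_×_)

IsGamma : ℕ → ℕ → Set
IsGamma m l = IsPeriodIndex m l × (∀ k → IsPeriodIndex m k → l Data.Nat.≤ k)
  where open import Data.Product using (_×_)
        import Data.Nat

-- Work in ℤ[φ] with φ² = φ + 1, where φ^(n+1) = u n + u (n+1) φ: n is a period of u modulo M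
-- exactly when φ^n ≡ 1 (mod M).  Let p be the largest prime factor of m = p^(e+1) k with p ∤ k, and
-- g = γ(p).  Since p² ∤ u g, the binomial theorem (with p ∣ p C 2 for odd p) shows by induction that
-- g p^j is a period modulo p^(j+1) with p^(j+2) ∤ u (g p^j), hence p^(j+1) ∣ u (g n) forces p^j ∣ n.
-- So m² ∣ u l, l = γ(m), gives l = p h where h is a period modulo p^(e+1).  Modulo a prime q < p
-- the Frobenius map of ℤ[φ]/q gives a period q - 1, 2(q + 1) or 20, and lifting to prime powers
-- and the Chinese remainder theorem give a period N of k with p ∤ N; as p h is also a period of k,
-- Bézout makes h a period of k.  Thus h < l is a period of m, contradicting the minimality of γ(m).
module Submission where

open import Algebra.Bundles using (CommutativeRing; CommutativeSemiring)
open import Algebra.Structures using (IsCommutativeRing)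
open import Data.Empty using (⊥-elim)
open import Data.Fin.Base as Fin using (Fin; fromℕ; inject₁)
open import Data.Fin.Properties using (toℕ-fromℕ; toℕ-inject₁; toℕ<n)
open import Data.Integer.Base as ℤ using (ℤ; +_; 0ℤ; 1ℤ)
import Data.Integer.Divisibility.Signed as ℤ
import Data.Integer.Properties as ℤ
import Data.Integer.Tactic.RingSolver as ℤSolver
open import Data.List.Base using ([]; _∷_)
import Data.List.Relation.Unary.All as All
open import Data.Maybe.Base using (just; nothing)
open import Data.Nat.Base as ℕ using (ℕ; zero; suc; _+_; _*_; _^_; _∸_; _<_; _≤_)
open import Data.Nat.Combinatorics using (_C_; nC1≡n; nCn≡1; nCk+nC[k+1]≡[n+1]C[k+1])
open import Data.Nat.Coprimality as Coprime using (Coprime; coprime-Bézout; coprime-divisor)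
open import Data.Nat.Divisibility using (_∣_)
import Data.Nat.Divisibility as ℕ
open import Data.Nat.DivMod using (_%_; _/_)
import Data.Nat.DivMod as ℕ
open import Data.Nat.GCD using (module Bézout)
open import Data.Nat.Induction using (<-rec)
open import Data.Nat.ListAction using (product)
open import Data.Nat.Primality using (Prime; prime?; prime⇒irreducible; prime⇒nonTrivial; euclidsLemma)
open import Data.Nat.Primality.Factorisation using (factorise)
import Data.Nat.Properties as ℕ
import Data.Nat.Tactic.RingSolver as ℕSolver
open import Data.Product.Base using (∃-syntax; _,_; _×_; proj₁; proj₂)
open import Data.Sum.Base as Sum using (_⊎_; inj₁; inj₂; [_,_]′)
open import Function.Base using (_$_; _∘_)
open import Function.Bundles using (_⇔_; mk⇔; Equivalence)
open import Relation.Binary.PropositionalEquality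
import Relation.Binary.Reasoning.Setoid
open import Relation.Nullary.Decidable using (Dec; yes; no; _×-dec_; from-yes)
open import Relation.Nullary.Negation using (¬_)
open import Relation.Unary using (Decidable)
open import Tactic.RingSolver using (solve; solve-∀)
open import Tactic.RingSolver.Core.AlmostCommutativeRing using (AlmostCommutativeRing; fromCommutativeRing)

open import Defs

-- The ring ℤ[φ], φ² = φ + 1, and congruences modulo its elements

infix 5 _+_·φ

data ℤφ : Set where
  _+_·φ : ℤ → ℤ → ℤφ

re im : ℤφ → ℤ
re (a + _ ·φ) = a
im (_ + b ·φ) = b

infixl 6 _⊕_
infixl 7 _⊗_
infix 8 ⊖_

-- a + b ·φ stands for a + bφ; the product below expands (a + bφ)(c + dφ) using φ² = φ + 1.
_⊕_ _⊗_ : ℤφ → ℤφ → ℤφ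
(a + b ·φ) ⊕ (c + d ·φ) = (a ℤ.+ c) + (b ℤ.+ d) ·φ
(a + b ·φ) ⊗ (c + d ·φ) = (a ℤ.* c ℤ.+ b ℤ.* d) + (a ℤ.* d ℤ.+ b ℤ.* c ℤ.+ b ℤ.* d) ·φ

⊖_ : ℤφ → ℤφ
⊖ (a + b ·φ) = ℤ.- a + ℤ.- b ·φ

𝟘 𝟙 φ : ℤφ
𝟘 = 0ℤ + 0ℤ ·φ
𝟙 = 1ℤ + 0ℤ ·φ
φ = 0ℤ + 1ℤ ·φ

⌜_⌝ : ℕ → ℤφ
⌜ n ⌝ = + n + 0ℤ ·φ

private
  ⊕-assoc : ∀ x y z → (x ⊕ y) ⊕ z ≡ x ⊕ (y ⊕ z)
  ⊕-assoc (a + b ·φ) (c + d ·φ) (e + f ·φ) = cong₂ _+_·φ (ℤ.+-assoc a c e) (ℤ.+-assoc b d f)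

  ⊕-comm : ∀ x y → x ⊕ y ≡ y ⊕ x
  ⊕-comm (a + b ·φ) (c + d ·φ) = cong₂ _+_·φ (ℤ.+-comm a c) (ℤ.+-comm b d)

  ⊕-identityˡ : ∀ x → 𝟘 ⊕ x ≡ x
  ⊕-identityˡ (a + b ·φ) = cong₂ _+_·φ (ℤ.+-identityˡ a) (ℤ.+-identityˡ b)

  ⊕-identityʳ : ∀ x → x ⊕ 𝟘 ≡ x
  ⊕-identityʳ (a + b ·φ) = cong₂ _+_·φ (ℤ.+-identityʳ a) (ℤ.+-identityʳ b)

  ⊖-inverseˡ : ∀ x → ⊖ x ⊕ x ≡ 𝟘
  ⊖-inverseˡ (a + b ·φ) = cong₂ _+_·φ (ℤ.+-inverseˡ a) (ℤ.+-inverseˡ b)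

  ⊖-inverseʳ : ∀ x → x ⊕ ⊖ x ≡ 𝟘
  ⊖-inverseʳ (a + b ·φ) = cong₂ _+_·φ (ℤ.+-inverseʳ a) (ℤ.+-inverseʳ b)

  ⊗-assoc : ∀ x y z → (x ⊗ y) ⊗ z ≡ x ⊗ (y ⊗ z)
  ⊗-assoc (a + b ·φ) (c + d ·φ) (e + f ·φ) =
    cong₂ _+_·φ (ℤSolver.solve (a ∷ b ∷ c ∷ d ∷ e ∷ f ∷ []))
                (ℤSolver.solve (a ∷ b ∷ c ∷ d ∷ e ∷ f ∷ []))

  ⊗-comm : ∀ x y → x ⊗ y ≡ y ⊗ x
  ⊗-comm (a + b ·φ) (c + d ·φ) =
    cong₂ _+_·φ (ℤSolver.solve (a ∷ b ∷ c ∷ d ∷ [])) (ℤSolver.solve (a ∷ b ∷ c ∷ d ∷ []))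

  ⊗-identityˡ : ∀ x → 𝟙 ⊗ x ≡ x
  ⊗-identityˡ (a + b ·φ) = cong₂ _+_·φ (ℤSolver.solve (a ∷ b ∷ [])) (ℤSolver.solve (a ∷ b ∷ []))

  ⊗-identityʳ : ∀ x → x ⊗ 𝟙 ≡ x
  ⊗-identityʳ (a + b ·φ) = cong₂ _+_·φ (ℤSolver.solve (a ∷ b ∷ [])) (ℤSolver.solve (a ∷ b ∷ []))

  ⊗-distribˡ : ∀ x y z → x ⊗ (y ⊕ z) ≡ x ⊗ y ⊕ x ⊗ z
  ⊗-distribˡ (a + b ·φ) (c + d ·φ) (e + f ·φ) =
    cong₂ _+_·φ (ℤSolver.solve (a ∷ b ∷ c ∷ d ∷ e ∷ f ∷ []))
                (ℤSolver.solve (a ∷ b ∷ c ∷ d ∷ e ∷ f ∷ []))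

  ⊗-distribʳ : ∀ x y z → (y ⊕ z) ⊗ x ≡ y ⊗ x ⊕ z ⊗ x
  ⊗-distribʳ (a + b ·φ) (c + d ·φ) (e + f ·φ) =
    cong₂ _+_·φ (ℤSolver.solve (a ∷ b ∷ c ∷ d ∷ e ∷ f ∷ []))
                (ℤSolver.solve (a ∷ b ∷ c ∷ d ∷ e ∷ f ∷ []))

ℤφ-isCommutativeRing : IsCommutativeRing _≡_ _⊕_ _⊗_ ⊖_ 𝟘 𝟙
ℤφ-isCommutativeRing = record
  { isRing = record
    { +-isAbelianGroup = record
      { isGroup = record
        { isMonoid = record
          { isSemigroup = record
            { isMagma = record { isEquivalence = isEquivalence ; ∙-cong = cong₂ _⊕_ }
            ; assoc = ⊕-assoc }
          ; identity = ⊕-identityˡ , ⊕-identityʳ }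
        ; inverse = ⊖-inverseˡ , ⊖-inverseʳ
        ; ⁻¹-cong = cong ⊖_ }
      ; comm = ⊕-comm }
    ; *-cong = cong₂ _⊗_
    ; *-assoc = ⊗-assoc
    ; *-identity = ⊗-identityˡ , ⊗-identityʳ
    ; distrib = ⊗-distribˡ , ⊗-distribʳ }
  ; *-comm = ⊗-comm }

ℤφ-commutativeRing : CommutativeRing _ _
ℤφ-commutativeRing = record { isCommutativeRing = ℤφ-isCommutativeRing }

private
  module R = CommutativeRing ℤφ-commutativeRing

ℤφ-ring : AlmostCommutativeRing _ _
ℤφ-ring = fromCommutativeRing ℤφ-commutativeRing λ where
  (+ 0 + + 0 ·φ) → just refl
  _ → nothing

infix 4 _∣ᵩ_
record _∣ᵩ_ (z x : ℤφ) : Set where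
  constructor divides
  field
    quotient : ℤφ
    equality : x ≡ z ⊗ quotient

∣ᵩ-refl : ∀ {z} → z ∣ᵩ z
∣ᵩ-refl {z} = divides 𝟙 (solve (z ∷ []) ℤφ-ring)

∣ᵩ-trans : ∀ {z w x} → z ∣ᵩ w → w ∣ᵩ x → z ∣ᵩ x
∣ᵩ-trans {z} (divides y refl) (divides y' refl) = divides (y ⊗ y') (solve (z ∷ y ∷ y' ∷ []) ℤφ-ring)

∣ᵩ-⊕ : ∀ {z x x'} → z ∣ᵩ x → z ∣ᵩ x' → z ∣ᵩ x ⊕ x'
∣ᵩ-⊕ {z} (divides y refl) (divides y' refl) = divides (y ⊕ y') (solve (z ∷ y ∷ y' ∷ []) ℤφ-ring)

∣ᵩ-⊖ : ∀ {z x} → z ∣ᵩ x → z ∣ᵩ ⊖ x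
∣ᵩ-⊖ {z} (divides y refl) = divides (⊖ y) (solve (z ∷ y ∷ []) ℤφ-ring)

∣ᵩ-⊗ˡ : ∀ {z x} w → z ∣ᵩ x → z ∣ᵩ w ⊗ x
∣ᵩ-⊗ˡ {z} w (divides y refl) = divides (w ⊗ y) (solve (z ∷ y ∷ w ∷ []) ℤφ-ring)

∣ᵩ-⊗ʳ : ∀ {z x} w → z ∣ᵩ x → z ∣ᵩ x ⊗ w
∣ᵩ-⊗ʳ {z} w (divides y refl) = divides (y ⊗ w) (solve (z ∷ y ∷ w ∷ []) ℤφ-ring)

∣ᵩ-⊗ : ∀ {a b c d} → a ∣ᵩ b → c ∣ᵩ d → a ⊗ c ∣ᵩ b ⊗ d
∣ᵩ-⊗ {a} {c = c} (divides y refl) (divides y' refl) = divides (y ⊗ y') (solve (a ∷ c ∷ y ∷ y' ∷ []) ℤφ-ring)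

∣ᵩ-respʳ : ∀ {z x y} → z ∣ᵩ x → x ≡ y → z ∣ᵩ y
∣ᵩ-respʳ d refl = d

infix 4 _≈_[mod_]
record _≈_[mod_] (x y z : ℤφ) : Set where
  constructor mk≈
  field ∣ᵩ-difference : z ∣ᵩ x ⊕ ⊖ y


≈-reflexive : ∀ {z x y} → x ≡ y → x ≈ y [mod z ]
≈-reflexive {z} {x} refl = mk≈ (divides 𝟘 (solve (x ∷ z ∷ []) ℤφ-ring))

≈-refl : ∀ {z x} → x ≈ x [mod z ]
≈-refl {z} = ≈-reflexive refl

≈-sym : ∀ {z x y} → x ≈ y [mod z ] → y ≈ x [mod z ]
≈-sym {z} {x} {y} (mk≈ d) = mk≈ (∣ᵩ-respʳ (∣ᵩ-⊖ d) (solve (x ∷ y ∷ []) ℤφ-ring))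

≈-trans : ∀ {z x y w} → x ≈ y [mod z ] → y ≈ w [mod z ] → x ≈ w [mod z ]
≈-trans {z} {x} {y} {w} (mk≈ d) (mk≈ d') =
  mk≈ (∣ᵩ-respʳ (∣ᵩ-⊕ d d') (solve (x ∷ y ∷ w ∷ []) ℤφ-ring))

≈-⊕ : ∀ {z x y x' y'} → x ≈ y [mod z ] → x' ≈ y' [mod z ] → x ⊕ x' ≈ y ⊕ y' [mod z ]
≈-⊕ {z} {x} {y} {x'} {y'} (mk≈ d) (mk≈ d') =
  mk≈ (∣ᵩ-respʳ (∣ᵩ-⊕ d d') (solve (x ∷ y ∷ x' ∷ y' ∷ []) ℤφ-ring))

≈-⊗ : ∀ {z x y x' y'} → x ≈ y [mod z ] → x' ≈ y' [mod z ] → x ⊗ x' ≈ y ⊗ y' [mod z ]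
≈-⊗ {z} {x} {y} {x'} {y'} (mk≈ d) (mk≈ d') =
  mk≈ (∣ᵩ-respʳ (∣ᵩ-⊕ (∣ᵩ-⊗ʳ x' d) (∣ᵩ-⊗ˡ y d')) (solve (x ∷ y ∷ x' ∷ y' ∷ []) ℤφ-ring))

∣ᵩ⇒≈𝟘 : ∀ {z x} → z ∣ᵩ x → x ≈ 𝟘 [mod z ]
∣ᵩ⇒≈𝟘 {z} {x} d = mk≈ (∣ᵩ-respʳ d (solve (x ∷ []) ℤφ-ring))

≈-weaken : ∀ {z w x y} → z ∣ᵩ w → x ≈ y [mod w ] → x ≈ y [mod z ]
≈-weaken z∣w (mk≈ d) = mk≈ (∣ᵩ-trans z∣w d)

ℤφ/_ : ℤφ → CommutativeSemiring _ _
ℤφ/ z = record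
  { _≈_ = λ x y → x ≈ y [mod z ]
  ; _+_ = _⊕_
  ; _*_ = _⊗_
  ; 0# = 𝟘
  ; 1# = 𝟙
  ; isCommutativeSemiring = record
    { isSemiring = record
      { isSemiringWithoutAnnihilatingZero = record
        { +-isCommutativeMonoid = record
          { isMonoid = record
            { isSemigroup = record
              { isMagma = record
                { isEquivalence = record { refl = ≈-refl ; sym = ≈-sym ; trans = ≈-trans }
                ; ∙-cong = ≈-⊕ }
              ; assoc = λ x y w → ≈-reflexive (R.+-assoc x y w) }
            ; identity = (λ x → ≈-reflexive (R.+-identityˡ x)) , (λ x → ≈-reflexive (R.+-identityʳ x)) }
          ; comm = λ x y → ≈-reflexive (R.+-comm x y) }
        ; *-cong = ≈-⊗
        ; *-assoc = λ x y w → ≈-reflexive (R.*-assoc x y w)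
        ; *-identity = (λ x → ≈-reflexive (R.*-identityˡ x)) , (λ x → ≈-reflexive (R.*-identityʳ x))
        ; distrib = (λ x y w → ≈-reflexive (R.distribˡ x y w)) , (λ x y w → ≈-reflexive (R.distribʳ x y w)) }
      ; zero = (λ x → ≈-reflexive (R.zeroˡ x)) , (λ x → ≈-reflexive (R.zeroʳ x)) }
    ; *-comm = λ x y → ≈-reflexive (R.*-comm x y) } }

module ≈-Reasoning (z : ℤφ) = Relation.Binary.Reasoning.Setoid (CommutativeSemiring.setoid (ℤφ/ z))

≈-drop : ∀ {z x y} → z ∣ᵩ y → x ⊕ y ≈ x [mod z ]
≈-drop {z} {x} {y} z∣y = begin
  x ⊕ y  ≈⟨ ≈-⊕ ≈-refl (∣ᵩ⇒≈𝟘 z∣y) ⟩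
  x ⊕ 𝟘  ≡⟨ R.+-identityʳ x ⟩
  x      ∎
  where open ≈-Reasoning z

≈-cancel-unit : ∀ {z v w x y} → v ⊗ w ≈ 𝟙 [mod z ] → w ⊗ x ≈ w ⊗ y [mod z ] → x ≈ y [mod z ]
≈-cancel-unit {z} {v} {w} {x} {y} vw≈𝟙 wx≈wy = begin
  x            ≡⟨ R.*-identityˡ x ⟨
  𝟙 ⊗ x        ≈⟨ ≈-⊗ (≈-sym vw≈𝟙) ≈-refl ⟩
  v ⊗ w ⊗ x    ≡⟨ R.*-assoc v w x ⟩
  v ⊗ (w ⊗ x)  ≈⟨ ≈-⊗ ≈-refl wx≈wy ⟩
  v ⊗ (w ⊗ y)  ≡⟨ R.*-assoc v w y ⟨
  v ⊗ w ⊗ y    ≈⟨ ≈-⊗ vw≈𝟙 ≈-refl ⟩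
  𝟙 ⊗ y        ≡⟨ R.*-identityˡ y ⟩
  y            ∎
  where open ≈-Reasoning z

open import Algebra.Properties.Semiring.Exp (CommutativeRing.semiring ℤφ-commutativeRing)
  using (^-homo-*; ^-assocʳ) renaming (_^_ to _^ᵩ_)
open import Algebra.Properties.CommutativeSemiring.Exp (CommutativeRing.commutativeSemiring ℤφ-commutativeRing)
  using (^-distrib-*)

^ᵩ-≈ : ∀ {z x y} n → x ≈ y [mod z ] → x ^ᵩ n ≈ y ^ᵩ n [mod z ]
^ᵩ-≈ zero x≈y = ≈-refl
^ᵩ-≈ (suc n) x≈y = ≈-⊗ x≈y (^ᵩ-≈ n x≈y)

𝟙^ᵩ : ∀ n → 𝟙 ^ᵩ n ≡ 𝟙
𝟙^ᵩ zero = refl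
𝟙^ᵩ (suc n) = cong (𝟙 ⊗_) (𝟙^ᵩ n)

⌜⌝-+ : ∀ m n → ⌜ m + n ⌝ ≡ ⌜ m ⌝ ⊕ ⌜ n ⌝
⌜⌝-+ m n = cong (_+ 0ℤ ·φ) (ℤ.pos-+ m n)

⌜⌝-* : ∀ m n → ⌜ m * n ⌝ ≡ ⌜ m ⌝ ⊗ ⌜ n ⌝
⌜⌝-* m n = trans (cong (_+ 0ℤ ·φ) (ℤ.pos-* m n)) (embed-* (+ m) (+ n))
  where
  embed-* : ∀ a b → a ℤ.* b + 0ℤ ·φ ≡ (a + 0ℤ ·φ) ⊗ (b + 0ℤ ·φ)
  embed-* a b = cong₂ _+_·φ (ℤSolver.solve (a ∷ b ∷ [])) (ℤSolver.solve (a ∷ b ∷ []))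

⌜⌝-∣ᵩ : ∀ {m n} → m ∣ n → ⌜ m ⌝ ∣ᵩ ⌜ n ⌝
⌜⌝-∣ᵩ {m} (ℕ.divides q refl) = divides ⌜ q ⌝ (trans (⌜⌝-* q m) (R.*-comm ⌜ q ⌝ ⌜ m ⌝))

⌜⌝-^ : ∀ a n → ⌜ a ^ n ⌝ ≡ ⌜ a ⌝ ^ᵩ n
⌜⌝-^ a zero = refl
⌜⌝-^ a (suc n) = trans (⌜⌝-* a (a ^ n)) (cong (⌜ a ⌝ ⊗_) (⌜⌝-^ a n))

scalar-∣ᵩ⇔ : ∀ {k a b} → k + 0ℤ ·φ ∣ᵩ a + b ·φ ⇔ (k ℤ.∣ a × k ℤ.∣ b)
scalar-∣ᵩ⇔ {k} = mk⇔
  (λ where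
    (divides (c + d ·φ) refl) →
      ℤ.divides c (ℤSolver.solve (k ∷ c ∷ d ∷ [])) , ℤ.divides d (ℤSolver.solve (k ∷ c ∷ d ∷ [])))
  (λ where
    (ℤ.divides c refl , ℤ.divides d refl) →
      divides (c + d ·φ) (cong₂ _+_·φ (ℤSolver.solve (k ∷ c ∷ d ∷ [])) (ℤSolver.solve (k ∷ c ∷ d ∷ []))))

-- By definition a ≡ b [mod m ] is the ℕ-divisibility m ∣ ∣ + a - + b ∣.
≡[mod]-refl : ∀ {a m} → a ≡ a [mod m ]
≡[mod]-refl {a} {m} = subst (m ∣_) (sym (cong ℤ.∣_∣ (ℤ.+-inverseʳ (+ a)))) (ℕ._∣0 m)

≡[mod]? : ∀ a b m → Dec (a ≡ b [mod m ])
≡[mod]? a b m = m ℕ.∣? ℤ.∣ + a ℤ.- + b ∣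

≡[mod]-∣ : ∀ {a b m d} → a ≡ b [mod m ] → d ∣ m → d ∣ a → d ∣ b
≡[mod]-∣ {a} {b} {m} {d} a≡b d∣m d∣a =
  ℤ.∣⇒∣ᵤ (subst (+ d ℤ.∣_) (ℤ.neg-involutive (+ b)) (ℤ.∣m⇒∣-m d∣-b))
  where
  d∣a-b : + d ℤ.∣ + a ℤ.- + b
  d∣a-b = ℤ.∣-trans (ℤ.∣ᵤ⇒∣ {+ d} {+ m} d∣m) (ℤ.∣ᵤ⇒∣ a≡b)
  d∣-b : + d ℤ.∣ ℤ.- + b
  d∣-b = ℤ.∣m+n∣m⇒∣n d∣a-b (ℤ.∣ᵤ⇒∣ {+ d} {+ a} d∣a)

private
  ∣+[a+n]-+a∣≡n : ∀ a n → ℤ.∣ + (a + n) ℤ.- + a ∣ ≡ n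
  ∣+[a+n]-+a∣≡n a n =
    trans (cong ℤ.∣_∣ (trans (ℤ.m-n≡m⊖n (a + n) a) (ℤ.⊖-≥ (ℕ.m≤m+n a n)))) (ℕ.m+n∸m≡n a n)

+≡[mod]⇒∣ : ∀ {a n m} → (a + n) ≡ a [mod m ] → m ∣ n
+≡[mod]⇒∣ {a} {n} {m} = subst (m ∣_) (∣+[a+n]-+a∣≡n a n)

∣⇒+≡[mod] : ∀ {a n m} → m ∣ n → (a + n) ≡ a [mod m ]
∣⇒+≡[mod] {a} {n} {m} = subst (m ∣_) (sym (∣+[a+n]-+a∣≡n a n))

coprime⇒*∣ : ∀ {a b n} → Coprime a b → a ∣ n → b ∣ n → a * b ∣ n
coprime⇒*∣ {a} {b} c (ℕ.divides t refl) b∣ta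
  with coprime-divisor (Coprime.sym c) (subst (b ∣_) (ℕ.*-comm t a) b∣ta)
... | ℕ.divides s refl = ℕ.divides s (ℕSolver.solve (s ∷ b ∷ a ∷ []))

≡[mod]-coprime-* : ∀ {a b x y} → Coprime a b → x ≡ y [mod a ] → x ≡ y [mod b ] → x ≡ y [mod a * b ]
≡[mod]-coprime-* = coprime⇒*∣

prime≢1 : ∀ {p} → Prime p → p ≢ 1
prime≢1 pp refl = ℕ.<-irrefl refl (ℕ.nonTrivial⇒n>1 1 {{prime⇒nonTrivial pp}})

prime⇒coprime : ∀ {p n} → Prime p → ¬ p ∣ n → Coprime p n
prime⇒coprime pp p∤n (d∣p , d∣n) with prime⇒irreducible pp d∣p
... | inj₁ d≡1 = d≡1
... | inj₂ refl = ⊥-elim (p∤n d∣n)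

coprime-*ˡ : ∀ {a b n} → Coprime a n → Coprime b n → Coprime (a * b) n
coprime-*ˡ ca cb (d∣ab , d∣n) =
  cb (coprime-divisor (λ (e∣d , e∣a) → ca (e∣a , ℕ.∣-trans e∣d d∣n)) d∣ab , d∣n)

coprime-^ˡ : ∀ {a n} → Coprime a n → ∀ k → Coprime (a ^ k) n
coprime-^ˡ c zero (d∣1 , _) = ℕ.∣1⇒≡1 d∣1
coprime-^ˡ c (suc k) = coprime-*ˡ c (coprime-^ˡ c k)

even-prime : ∀ {p} → Prime p → 2 ∣ p → p ≡ 2
even-prime pp 2∣p = [ (λ ()) , sym ]′ (prime⇒irreducible pp 2∣p)

odd-prime : ∀ {q} → Prime q → 3 ≤ q → ∃[ r ] q ≡ suc (2 * r)
odd-prime {q} pq 3≤q with q % 2 | ℕ.m≡m%n+[m/n]*n q 2 | ℕ.m%n<n q 2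
... | 0 | q≡[q/2]*2 | _ = ⊥-elim (ℕ.<-irrefl (sym (even-prime pq (ℕ.divides (q / 2) q≡[q/2]*2))) 3≤q)
... | 1 | q≡1+[q/2]*2 | _ = q / 2 , trans q≡1+[q/2]*2 (cong suc (ℕ.*-comm (q / 2) 2))
... | suc (suc _) | _ | ℕ.s≤s (ℕ.s≤s ())

prime∤-< : ∀ {p n} → 0 < n → n < p → ¬ p ∣ n
prime∤-< 0<n n<p p∣n = ℕ.<⇒≱ n<p (ℕ.∣⇒≤ {{ℕ.>-nonZero 0<n}} p∣n)

prime∤-* : ∀ {p m n} → Prime p → ¬ p ∣ m → ¬ p ∣ n → ¬ p ∣ m * n
prime∤-* {m = m} {n} pp p∤m p∤n p∣mn = [ p∤m , p∤n ]′ (euclidsLemma m n pp p∣mn)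

prime-factor : ∀ {n} → 1 < n → ∃[ q ] Prime q × q ∣ n
prime-factor {n} 1<n with factorise n {{ℕ.>-nonZero (ℕ.<-trans ℕ.z<s 1<n)}}
... | record { factors = [] ; isFactorisation = n≡1 } = ⊥-elim (ℕ.<-irrefl (sym n≡1) 1<n)
... | record { factors = q ∷ qs ; isFactorisation = n≡q*qs ; factorsPrime = pq All.∷ _ } =
  q , pq , ℕ.divides (product qs) (trans n≡q*qs (ℕ.*-comm q (product qs)))

least : ∀ {P : ℕ → Set} → Decidable P → ∀ {n} → P n → ∃[ m ] P m × (∀ k → P k → m ≤ k)
least {P} P? {n} = <-rec (λ n → P n → ∃[ m ] P m × (∀ k → P k → m ≤ k)) search n
  where
  search : ∀ n → (∀ {j} → j < n → P j → ∃[ m ] P m × (∀ k → P k → m ≤ k)) → P n →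
           ∃[ m ] P m × (∀ k → P k → m ≤ k)
  search n smaller pn with ℕ.anyUpTo? P? n
  ... | yes (j , j<n , pj) = smaller j<n pj
  ... | no ∄smaller = n , pn , λ k pk → ℕ.≮⇒≥ λ k<n → ∄smaller (k , k<n , pk)

largest-prime-factor : ∀ {m} → 1 < m → ∃[ p ] Prime p × p ∣ m × (∀ q → Prime q → q ∣ m → q ≤ p)
largest-prime-factor {m} 1<m = conclude (least P? {m ∸ q} (complement pq q∣m))
  where
  instance _ = ℕ.>-nonZero (ℕ.<-trans ℕ.z<s 1<m)
  P : ℕ → Set
  P i = Prime (m ∸ i) × (m ∸ i) ∣ m
  P? : Decidable P
  P? i = prime? (m ∸ i) ×-dec (m ∸ i) ℕ.∣? m
  complement : ∀ {q} → Prime q → q ∣ m → P (m ∸ q)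
  complement pq q∣m rewrite ℕ.m∸[m∸n]≡n (ℕ.∣⇒≤ q∣m) = pq , q∣m
  q : ℕ
  q = proj₁ (prime-factor 1<m)
  pq : Prime q
  pq = proj₁ (proj₂ (prime-factor 1<m))
  q∣m : q ∣ m
  q∣m = proj₂ (proj₂ (prime-factor 1<m))
  conclude : ∃[ i ] P i × (∀ k → P k → i ≤ k) →
             ∃[ p ] Prime p × p ∣ m × (∀ q → Prime q → q ∣ m → q ≤ p)
  conclude (i , (pp , p∣m) , least-i) = m ∸ i , pp , p∣m , λ q pq q∣m →
    subst (_≤ m ∸ i) (ℕ.m∸[m∸n]≡n (ℕ.∣⇒≤ q∣m))
          (ℕ.∸-monoʳ-≤ m (least-i (m ∸ q) (complement pq q∣m)))

p-adic-decomposition : ∀ {p} → Prime p → ∀ m → 0 < m → ∃[ e ] ∃[ k ] m ≡ p ^ e * k × ¬ p ∣ k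
p-adic-decomposition {p} pp = <-rec Goal step
  where
  Goal : ℕ → Set
  Goal m = 0 < m → ∃[ e ] ∃[ k ] m ≡ p ^ e * k × ¬ p ∣ k
  step : ∀ m → (∀ {j} → j < m → Goal j) → Goal m
  step m smaller 0<m with p ℕ.∣? m
  ... | no p∤m = 0 , m , sym (ℕ.+-identityʳ m) , p∤m
  ... | yes (ℕ.divides m' refl) with smaller m'<m 0<m'
    where
    0<m' : 0 < m'
    0<m' = ℕ.n≢0⇒n>0 λ { refl → ℕ.<-irrefl refl 0<m }
    m'<m : m' < m' * p
    m'<m = ℕ.m<m*n m' p {{ℕ.>-nonZero 0<m'}} (ℕ.nonTrivial⇒n>1 p {{prime⇒nonTrivial pp}})
  ... | e , k , refl , p∤k = suc e , k , shift (p ^ e) , p∤k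
    where shift : ∀ x → x * k * p ≡ p * x * k
          shift x = trans (ℕ.*-comm (x * k) p) (sym (ℕ.*-assoc p x k))

p^[2+j]∣[p^[1+j]]² : ∀ p j → p ^ suc (suc j) ∣ p ^ suc j * p ^ suc j
p^[2+j]∣[p^[1+j]]² p j = ℕ.divides (p ^ j) (square-split p (p ^ j))
  where square-split : ∀ a b → (a * b) * (a * b) ≡ b * (a * (a * b))
        square-split = ℕSolver.solve-∀

p^[2+j]∣m² : ∀ {p j m} → p ^ suc j ∣ m → p ^ suc (suc j) ∣ m ^ 2
p^[2+j]∣m² {p} {j} {m} p^[1+j]∣m = ℕ.∣-trans (p^[2+j]∣[p^[1+j]]² p j)
  (ℕ.∣-trans (ℕ.*-pres-∣ p^[1+j]∣m p^[1+j]∣m)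
             (ℕ.∣-reflexive (cong (m *_) (sym (ℕ.*-identityʳ m)))))

C-absorption : ∀ n k → suc k * (suc n C suc k) ≡ suc n * (n C k)
C-absorption zero zero = refl
C-absorption zero (suc k) = ℕ.*-zeroʳ (suc (suc k))
C-absorption (suc n) zero = trans (ℕ.+-identityʳ _) (trans (nC1≡n (suc (suc n))) (sym (ℕ.*-identityʳ _)))
C-absorption (suc n) (suc k) = begin
  suc (suc k) * (suc (suc n) C suc (suc k))
    ≡⟨ cong (suc (suc k) *_) (nCk+nC[k+1]≡[n+1]C[k+1] (suc n) (suc k)) ⟨
  suc (suc k) * (a + b)
    ≡⟨ distribute k a b ⟩
  suc k * a + a + suc (suc k) * b
    ≡⟨ cong₂ (λ s t → s + a + t) (C-absorption n k) (C-absorption n (suc k)) ⟩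
  suc n * (n C k) + a + suc n * (n C suc k)
    ≡⟨ collect n a (n C k) (n C suc k) ⟩
  suc n * (n C k + n C suc k) + a
    ≡⟨ cong (λ t → suc n * t + a) (nCk+nC[k+1]≡[n+1]C[k+1] n k) ⟩
  suc n * a + a
    ≡⟨ absorb n a ⟩
  suc (suc n) * a  ∎
  where
  open ≡-Reasoning
  a b : ℕ
  a = suc n C suc k
  b = suc n C suc (suc k)
  distribute : ∀ k a b → suc (suc k) * (a + b) ≡ suc k * a + a + suc (suc k) * b
  distribute = ℕSolver.solve-∀
  collect : ∀ n a c d → suc n * c + a + suc n * d ≡ suc n * (c + d) + a
  collect = ℕSolver.solve-∀
  absorb : ∀ n a → suc n * a + a ≡ suc (suc n) * a
  absorb = ℕSolver.solve-∀

prime∣C : ∀ {q k} → Prime q → 0 < k → k < q → q ∣ q C k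
prime∣C {suc q} {suc k} pq _ k<q
  with euclidsLemma (suc k) (suc q C suc k) pq
         (ℕ.divides (q C k) (trans (C-absorption q k) (ℕ.*-comm (suc q) (q C k))))
... | inj₂ q∣C = q∣C
... | inj₁ q∣k = ⊥-elim (ℕ.<⇒≱ k<q (ℕ.∣⇒≤ q∣k))

sucC2 : ∀ n → suc n C 2 ≡ n C 2 + n
sucC2 n = begin
  suc n C 2      ≡⟨ nCk+nC[k+1]≡[n+1]C[k+1] n 1 ⟨
  n C 1 + n C 2  ≡⟨ cong (_+ n C 2) (nC1≡n n) ⟩
  n + n C 2      ≡⟨ ℕ.+-comm n (n C 2) ⟩
  n C 2 + n      ∎
  where open ≡-Reasoning

oddC2 : ∀ r → suc (2 * r) C 2 ≡ suc (2 * r) * r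
oddC2 zero = refl
oddC2 (suc r) = begin
  suc (2 * suc r) C 2
    ≡⟨ cong (λ n → suc n C 2) (ℕ.*-suc 2 r) ⟩
  suc (suc (suc (2 * r))) C 2
    ≡⟨ sucC2 (suc (suc (2 * r))) ⟩
  suc (suc (2 * r)) C 2 + suc (suc (2 * r))
    ≡⟨ cong (_+ suc (suc (2 * r))) (sucC2 (suc (2 * r))) ⟩
  suc (2 * r) C 2 + suc (2 * r) + suc (suc (2 * r))
    ≡⟨ cong (λ t → t + suc (2 * r) + suc (suc (2 * r))) (oddC2 r) ⟩
  suc (2 * r) * r + suc (2 * r) + suc (suc (2 * r))
    ≡⟨ ℕSolver.solve (r ∷ []) ⟩
  suc (2 * suc r) * suc r  ∎
  where open ≡-Reasoning

[1+r]*2≡2+2r : ∀ r → suc r * 2 ≡ suc (suc (2 * r))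
[1+r]*2≡2+2r = ℕSolver.solve-∀

-- Periods of the Fibonacci sequence

φ^suc : ∀ n → φ ^ᵩ suc n ≡ + u n + + u (suc n) ·φ
φ^suc zero = refl
φ^suc (suc n) = begin
  φ ⊗ φ ^ᵩ suc n                          ≡⟨ cong (φ ⊗_) (φ^suc n) ⟩
  φ ⊗ (+ u n + + u (suc n) ·φ)            ≡⟨ φ⊗ (+ u n) (+ u (suc n)) ⟩
  + u (suc n) + + u (suc n) ℤ.+ + u n ·φ  ≡⟨ cong (+ u (suc n) +_·φ) (ℤ.pos-+ (u (suc n)) (u n)) ⟨
  + u (suc n) + + u (suc (suc n)) ·φ      ∎
  where
  open ≡-Reasoning
  φ⊗ : ∀ a b → φ ⊗ (a + b ·φ) ≡ b + b ℤ.+ a ·φ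
  φ⊗ a b = cong₂ _+_·φ (ℤSolver.solve (a ∷ b ∷ [])) (ℤSolver.solve (a ∷ b ∷ []))

≈⇔≡[mod] : ∀ {M a b c d} →
           + a + + b ·φ ≈ + c + + d ·φ [mod ⌜ M ⌝ ] ⇔ (a ≡ c [mod M ] × b ≡ d [mod M ])
≈⇔≡[mod] = mk⇔
  (λ (mk≈ d) → let (∣re , ∣im) = Equivalence.to scalar-∣ᵩ⇔ d in ℤ.∣⇒∣ᵤ ∣re , ℤ.∣⇒∣ᵤ ∣im)
  (λ (∣re , ∣im) → mk≈ (Equivalence.from scalar-∣ᵩ⇔ (ℤ.∣ᵤ⇒∣ ∣re , ℤ.∣ᵤ⇒∣ ∣im)))

record Period (M n : ℕ) : Set where
  constructor period
  field φ^n≈𝟙 : φ ^ᵩ n ≈ 𝟙 [mod ⌜ M ⌝ ]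


period⇔ : ∀ {M n} → Period M n ⇔ (u n ≡ 0 [mod M ] × u (suc n) ≡ 1 [mod M ])
period⇔ {M} {n} = mk⇔
  (λ (period per) →
    Equivalence.to ≈⇔≡[mod] (subst (_≈ φ [mod ⌜ M ⌝ ]) (φ^suc n) (≈-⊗ (≈-refl {x = φ}) per)))
  (λ ≡[mod] → period (≈-cancel-unit {v = φ ⊕ ⊖ 𝟙} (≈-reflexive refl)
                (subst (_≈ φ ⊗ 𝟙 [mod ⌜ M ⌝ ]) (sym (φ^suc n)) (Equivalence.from ≈⇔≡[mod] ≡[mod]))))

isPeriodIndex⇒period : ∀ {M n} → IsPeriodIndex M n → Period M n
isPeriodIndex⇒period {M} {n} (_ , ≡[mod]) = Equivalence.from (period⇔ {M} {n}) ≡[mod]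

period⇒isPeriodIndex : ∀ {M n} → 0 < n → Period M n → IsPeriodIndex M n
period⇒isPeriodIndex {M} {n} 0<n per = 0<n , Equivalence.to (period⇔ {M} {n}) per

module _ {M : ℕ} where

  period-*ʳ : ∀ {a} t → Period M a → Period M (a * t)
  period-*ʳ {a} t (period pa) = period $ begin
    φ ^ᵩ (a * t)   ≡⟨ ^-assocʳ φ a t ⟨
    (φ ^ᵩ a) ^ᵩ t  ≈⟨ ^ᵩ-≈ t pa ⟩
    𝟙 ^ᵩ t         ≡⟨ 𝟙^ᵩ t ⟩
    𝟙              ∎
    where open ≈-Reasoning ⌜ M ⌝

  period-*ˡ : ∀ {a} t → Period M a → Period M (t * a)
  period-*ˡ {a} t pa = subst (Period M) (ℕ.*-comm a t) (period-*ʳ t pa)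

  period-cancel : ∀ {a b} → Period M (a + b) → Period M b → Period M a
  period-cancel {a} {b} (period pab) (period pb) = period $ begin
    φ ^ᵩ a           ≡⟨ R.*-identityʳ (φ ^ᵩ a) ⟨
    φ ^ᵩ a ⊗ 𝟙       ≈⟨ ≈-⊗ ≈-refl pb ⟨
    φ ^ᵩ a ⊗ φ ^ᵩ b  ≡⟨ ^-homo-* φ a b ⟨
    φ ^ᵩ (a + b)     ≈⟨ pab ⟩
    𝟙                ∎
    where open ≈-Reasoning ⌜ M ⌝

  period-coprime-cancel : ∀ {p N h} → Coprime p N → Period M N → Period M (p * h) → Period M h
  period-coprime-cancel {p} {N} {h} c pN pph with coprime-Bézout c
  ... | Bézout.+- x y eq =
    period-cancel (subst (Period M) (≡-x*[p*h]) (period-*ˡ x pph)) (period-*ˡ (h * y) pN)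
    where
    ≡-x*[p*h] : x * (p * h) ≡ h + h * y * N
    ≡-x*[p*h] = begin
      x * (p * h)      ≡⟨ ℕSolver.solve (x ∷ p ∷ h ∷ []) ⟩
      h * (x * p)      ≡⟨ cong (h *_) eq ⟨
      h * (1 + y * N)  ≡⟨ ℕSolver.solve (h ∷ y ∷ N ∷ []) ⟩
      h + h * y * N    ∎
      where open ≡-Reasoning
  ... | Bézout.-+ x y eq =
    period-cancel (subst (Period M) ≡-h*y*N (period-*ˡ (h * y) pN)) (period-*ˡ x pph)
    where
    ≡-h*y*N : h * y * N ≡ h + x * (p * h)
    ≡-h*y*N = begin
      h * y * N        ≡⟨ ℕ.*-assoc h y N ⟩
      h * (y * N)      ≡⟨ cong (h *_) eq ⟨
      h * (1 + x * p)  ≡⟨ ℕSolver.solve (h ∷ x ∷ p ∷ []) ⟩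
      h + x * (p * h)  ∎
      where open ≡-Reasoning

period-∣ : ∀ {M M' n} → M' ∣ M → Period M n → Period M' n
period-∣ M'∣M (period per) = period (≈-weaken (⌜⌝-∣ᵩ M'∣M) per)

period-1 : ∀ n → Period 1 n
period-1 n = period $ mk≈ (divides (φ ^ᵩ n ⊕ ⊖ 𝟙) (sym (R.*-identityˡ _)))

period-coprime-* : ∀ {a b n} → Coprime a b → Period a n → Period b n → Period (a * b) n
period-coprime-* {a} {b} {n} c pa pb =
  Equivalence.from (period⇔ {a * b} {n})
    ( ≡[mod]-coprime-* {x = u n} {y = 0} c (proj₁ a-index) (proj₁ b-index)
    , ≡[mod]-coprime-* {x = u (suc n)} {y = 1} c (proj₂ a-index) (proj₂ b-index))
  where
  a-index : u n ≡ 0 [mod a ] × u (suc n) ≡ 1 [mod a ]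
  a-index = Equivalence.to (period⇔ {a} {n}) pa
  b-index : u n ≡ 0 [mod b ] × u (suc n) ≡ 1 [mod b ]
  b-index = Equivalence.to (period⇔ {b} {n}) pb

isPeriodIndex? : ∀ M → Decidable (IsPeriodIndex M)
isPeriodIndex? M n = (0 ℕ.<? n) ×-dec (≡[mod]? (u n) 0 M ×-dec ≡[mod]? (u (suc n)) 1 M)

γ-exists : ∀ {M n} → 0 < n → Period M n → ∃[ g ] IsGamma M g
γ-exists 0<n per = least (isPeriodIndex? _) (period⇒isPeriodIndex 0<n per)

γ∣period : ∀ {M g n} → IsGamma M g → Period M n → g ∣ n
γ∣period {M} {g} {n} (g-index@(0<g , _) , minimal) per =
  ℕ.m%n≡0⇒n∣m n g (ℕ.n≤0⇒n≡0 (ℕ.≮⇒≥ λ 0<r →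
    ℕ.<⇒≱ (ℕ.m%n<n n g) (minimal (n % g) (period⇒isPeriodIndex 0<r period-remainder))))
  where
  instance _ = ℕ.>-nonZero 0<g
  period-remainder : Period M (n % g)
  period-remainder = period-cancel (subst (Period M) (ℕ.m≡m%n+[m/n]*n n g) per)
                                   (period-*ˡ (n / g) (isPeriodIndex⇒period g-index))

-- Lifting periods to prime powers

binomial₂-≈ : ∀ {c x} n → c ∣ᵩ x →
  (𝟙 ⊕ x) ^ᵩ n ≈ 𝟙 ⊕ ⌜ n ⌝ ⊗ x ⊕ ⌜ n C 2 ⌝ ⊗ (x ⊗ x) [mod c ⊗ c ⊗ c ]
binomial₂-≈ {c} {x} zero c∣x = ≈-reflexive (solve (x ∷ []) ℤφ-ring)
binomial₂-≈ {c} {x} (suc n) c∣x = begin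
  (𝟙 ⊕ x) ⊗ (𝟙 ⊕ x) ^ᵩ n                                 ≈⟨ ≈-⊗ ≈-refl (binomial₂-≈ n c∣x) ⟩
  (𝟙 ⊕ x) ⊗ (𝟙 ⊕ N ⊗ x ⊕ T ⊗ (x ⊗ x))                    ≡⟨ multiply-out x N T ⟩
  𝟙 ⊕ (𝟙 ⊕ N) ⊗ x ⊕ (T ⊕ N) ⊗ (x ⊗ x) ⊕ T ⊗ (x ⊗ x ⊗ x)  ≈⟨ ≈-drop (∣ᵩ-⊗ˡ T (∣ᵩ-⊗ (∣ᵩ-⊗ c∣x c∣x) c∣x)) ⟩
  𝟙 ⊕ (𝟙 ⊕ N) ⊗ x ⊕ (T ⊕ N) ⊗ (x ⊗ x)                    ≡⟨ cong (λ t → 𝟙 ⊕ ⌜ suc n ⌝ ⊗ x ⊕ t ⊗ (x ⊗ x)) C2≡ ⟩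
  𝟙 ⊕ ⌜ suc n ⌝ ⊗ x ⊕ ⌜ suc n C 2 ⌝ ⊗ (x ⊗ x)            ∎
  where
  open ≈-Reasoning (c ⊗ c ⊗ c)
  N T : ℤφ
  N = ⌜ n ⌝
  T = ⌜ n C 2 ⌝
  multiply-out : ∀ x N T → (𝟙 ⊕ x) ⊗ (𝟙 ⊕ N ⊗ x ⊕ T ⊗ (x ⊗ x)) ≡
                           𝟙 ⊕ (𝟙 ⊕ N) ⊗ x ⊕ (T ⊕ N) ⊗ (x ⊗ x) ⊕ T ⊗ (x ⊗ x ⊗ x)
  multiply-out = solve-∀ ℤφ-ring
  C2≡ : T ⊕ N ≡ ⌜ suc n C 2 ⌝
  C2≡ = trans (sym (⌜⌝-+ (n C 2) n)) (cong ⌜_⌝ (sym (sucC2 n)))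

≡𝟙⊕[-𝟙] : ∀ y → y ≡ 𝟙 ⊕ (y ⊕ ⊖ 𝟙)
≡𝟙⊕[-𝟙] = solve-∀ ℤφ-ring

binomial-≈ : ∀ {c y} n → c ∣ᵩ y ⊕ ⊖ 𝟙 → y ^ᵩ n ≈ 𝟙 ⊕ ⌜ n ⌝ ⊗ (y ⊕ ⊖ 𝟙) [mod c ⊗ c ]
binomial-≈ {c} {y} n c∣x = begin
  y ^ᵩ n                               ≡⟨ cong (_^ᵩ n) (≡𝟙⊕[-𝟙] y) ⟩
  (𝟙 ⊕ x) ^ᵩ n                         ≈⟨ ≈-weaken (divides c refl) (binomial₂-≈ n c∣x) ⟩
  𝟙 ⊕ ⌜ n ⌝ ⊗ x ⊕ ⌜ n C 2 ⌝ ⊗ (x ⊗ x)  ≈⟨ ≈-drop (∣ᵩ-⊗ˡ ⌜ n C 2 ⌝ (∣ᵩ-⊗ c∣x c∣x)) ⟩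
  𝟙 ⊕ ⌜ n ⌝ ⊗ x                        ∎
  where
  open ≈-Reasoning (c ⊗ c)
  x : ℤφ
  x = y ⊕ ⊖ 𝟙

-- As p C 2 = p r, the quadratic term of the binomial expansion vanishes modulo p c².
binomial-odd-≈ : ∀ {c y} r → let p = suc (2 * r) in ⌜ p ⌝ ∣ᵩ c → c ∣ᵩ y ⊕ ⊖ 𝟙 →
  y ^ᵩ p ≈ 𝟙 ⊕ ⌜ p ⌝ ⊗ (y ⊕ ⊖ 𝟙) [mod ⌜ p ⌝ ⊗ (c ⊗ c) ]
binomial-odd-≈ {c} {y} r p∣c c∣x = begin
  y ^ᵩ p
    ≡⟨ cong (_^ᵩ p) (≡𝟙⊕[-𝟙] y) ⟩
  (𝟙 ⊕ x) ^ᵩ p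
    ≈⟨ ≈-weaken (∣ᵩ-respʳ (∣ᵩ-⊗ p∣c ∣ᵩ-refl) (sym (R.*-assoc c c c))) (binomial₂-≈ p c∣x) ⟩
  𝟙 ⊕ P ⊗ x ⊕ ⌜ p C 2 ⌝ ⊗ (x ⊗ x)
    ≡⟨ cong (λ t → 𝟙 ⊕ P ⊗ x ⊕ t ⊗ (x ⊗ x)) (trans (cong ⌜_⌝ (oddC2 r)) (⌜⌝-* p r)) ⟩
  𝟙 ⊕ P ⊗ x ⊕ P ⊗ ⌜ r ⌝ ⊗ (x ⊗ x)
    ≈⟨ ≈-drop (∣ᵩ-respʳ (∣ᵩ-⊗ʳ ⌜ r ⌝ (∣ᵩ-⊗ (∣ᵩ-refl {P}) (∣ᵩ-⊗ c∣x c∣x))) (rearrange P ⌜ r ⌝ x)) ⟩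
  𝟙 ⊕ P ⊗ x  ∎
  where
  p : ℕ
  p = suc (2 * r)
  P x : ℤφ
  P = ⌜ p ⌝
  x = y ⊕ ⊖ 𝟙
  open ≈-Reasoning (P ⊗ (c ⊗ c))
  rearrange : ∀ P R x → P ⊗ (x ⊗ x) ⊗ R ≡ P ⊗ R ⊗ (x ⊗ x)
  rearrange = solve-∀ ℤφ-ring

im-φ^ : ∀ n → im (φ ^ᵩ n) ≡ + u n
im-φ^ zero = refl
im-φ^ (suc n) = cong im (φ^suc n)

im-≈ : ∀ {K x y} → x ≈ y [mod ⌜ K ⌝ ] → + K ℤ.∣ im x ℤ.- im y
im-≈ {x = _ + _ ·φ} {_ + _ ·φ} (mk≈ K∣) = proj₂ (Equivalence.to scalar-∣ᵩ⇔ K∣)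

im-𝟙⊕⌜⌝⊗[-𝟙] : ∀ t y → im (𝟙 ⊕ ⌜ t ⌝ ⊗ (y ⊕ ⊖ 𝟙)) ≡ + t ℤ.* im y
im-𝟙⊕⌜⌝⊗[-𝟙] t (a + b ·φ) = scalar-case (+ t) a b
  where
  scalar-case : ∀ k a b →
    0ℤ ℤ.+ (k ℤ.* (b ℤ.+ ℤ.- 0ℤ) ℤ.+ 0ℤ ℤ.* (a ℤ.+ ℤ.- 1ℤ) ℤ.+ 0ℤ ℤ.* (b ℤ.+ ℤ.- 0ℤ)) ≡ k ℤ.* b
  scalar-case = ℤSolver.solve-∀

φ^≈⇒u≡ : ∀ {K k t n} → φ ^ᵩ k ≈ 𝟙 ⊕ ⌜ t ⌝ ⊗ (φ ^ᵩ n ⊕ ⊖ 𝟙) [mod ⌜ K ⌝ ] → u k ≡ t * u n [mod K ]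
φ^≈⇒u≡ {K} {k} {t} {n} φ^k≈ = ℤ.∣⇒∣ᵤ (subst (+ K ℤ.∣_) im-difference (im-≈ φ^k≈))
  where
  im-difference : im (φ ^ᵩ k) ℤ.- im (𝟙 ⊕ ⌜ t ⌝ ⊗ (φ ^ᵩ n ⊕ ⊖ 𝟙)) ≡ + u k ℤ.- + (t * u n)
  im-difference = cong₂ ℤ._-_ (im-φ^ k)
    (trans (im-𝟙⊕⌜⌝⊗[-𝟙] t (φ ^ᵩ n)) (trans (cong (+ t ℤ.*_) (im-φ^ n)) (sym (ℤ.pos-* t (u n)))))

period-lift : ∀ {q M n} → Period (q * M) n → Period (q * (q * M)) (n * q)
period-lift {q} {M} {n} (period (mk≈ c∣x)) = period $ begin
  φ ^ᵩ (n * q)   ≡⟨ ^-assocʳ φ n q ⟨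
  (φ ^ᵩ n) ^ᵩ q  ≈⟨ ≈-weaken qc∣c⊗c (binomial-≈ q c∣x) ⟩
  𝟙 ⊕ ⌜ q ⌝ ⊗ x  ≈⟨ ≈-drop (subst (_∣ᵩ ⌜ q ⌝ ⊗ x) (sym (⌜⌝-* q (q * M))) (∣ᵩ-⊗ ∣ᵩ-refl c∣x)) ⟩
  𝟙              ∎
  where
  open ≈-Reasoning ⌜ q * (q * M) ⌝
  c x : ℤφ
  c = ⌜ q * M ⌝
  x = φ ^ᵩ n ⊕ ⊖ 𝟙
  qc∣c⊗c : ⌜ q * (q * M) ⌝ ∣ᵩ c ⊗ c
  qc∣c⊗c = subst (_∣ᵩ c ⊗ c) (sym (⌜⌝-* q (q * M))) (∣ᵩ-⊗ (⌜⌝-∣ᵩ (ℕ.m∣m*n {q} M)) ∣ᵩ-refl)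

u-*-≡ : ∀ {M n} t → Period M n → u (n * t) ≡ t * u n [mod M * M ]
u-*-≡ {M} {n} t (period (mk≈ M∣x)) = φ^≈⇒u≡ {M * M} {n * t} {t} {n} (begin
  φ ^ᵩ (n * t)
    ≡⟨ ^-assocʳ φ n t ⟨
  (φ ^ᵩ n) ^ᵩ t
    ≈⟨ ≈-weaken (subst (_∣ᵩ ⌜ M ⌝ ⊗ ⌜ M ⌝) (sym (⌜⌝-* M M)) ∣ᵩ-refl) (binomial-≈ t M∣x) ⟩
  𝟙 ⊕ ⌜ t ⌝ ⊗ (φ ^ᵩ n ⊕ ⊖ 𝟙)  ∎)
  where open ≈-Reasoning ⌜ M * M ⌝

u-*-odd-≡ : ∀ {M n} r → let p = suc (2 * r) in
  Period (p * M) n → u (n * p) ≡ p * u n [mod p * ((p * M) * (p * M)) ]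
u-*-odd-≡ {M} {n} r (period (mk≈ c∣x)) =
  φ^≈⇒u≡ {suc (2 * r) * _} {n * suc (2 * r)} {suc (2 * r)} {n} (begin
  φ ^ᵩ (n * p)                ≡⟨ ^-assocʳ φ n p ⟨
  (φ ^ᵩ n) ^ᵩ p               ≈⟨ ≈-weaken modulus (binomial-odd-≈ r (⌜⌝-∣ᵩ (ℕ.m∣m*n {p} M)) c∣x) ⟩
  𝟙 ⊕ ⌜ p ⌝ ⊗ (φ ^ᵩ n ⊕ ⊖ 𝟙)  ∎)
  where
  p : ℕ
  p = suc (2 * r)
  c : ℤφ
  c = ⌜ p * M ⌝
  open ≈-Reasoning ⌜ p * ((p * M) * (p * M)) ⌝
  modulus : ⌜ p * ((p * M) * (p * M)) ⌝ ∣ᵩ ⌜ p ⌝ ⊗ (c ⊗ c)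
  modulus = subst (_∣ᵩ ⌜ p ⌝ ⊗ (c ⊗ c))
                  (sym (trans (⌜⌝-* p _) (cong (⌜ p ⌝ ⊗_) (⌜⌝-* (p * M) (p * M))))) ∣ᵩ-refl

module _ (r : ℕ) {g : ℕ} (pp : Prime (suc (2 * r))) (per-g : Period (suc (2 * r)) g)
         (p²∤u[g] : ¬ suc (2 * r) ^ 2 ∣ u g) where

  private
    p : ℕ
    p = suc (2 * r)

  period∧valuation : ∀ j → Period (p ^ suc j) (g * p ^ j) × ¬ p ^ suc (suc j) ∣ u (g * p ^ j)
  period∧valuation zero = subst₂ Period (sym (ℕ.*-identityʳ p)) (sym (ℕ.*-identityʳ g)) per-g
                        , subst (λ n → ¬ p ^ 2 ∣ u n) (sym (ℕ.*-identityʳ g)) p²∤u[g]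
  period∧valuation (suc j) = subst (Period (p ^ suc (suc j))) index-≡ (period-lift per)
                           , λ p^j+3∣ → p^j+2∤ (ℕ.*-cancelˡ-∣ p
                               (≡[mod]-∣ (u-*-odd-≡ r per) modulus-∣
                                         (subst (λ n → p ^ suc (suc (suc j)) ∣ u n) (sym index-≡) p^j+3∣)))
    where
    per : Period (p ^ suc j) (g * p ^ j)
    per = proj₁ (period∧valuation j)
    p^j+2∤ : ¬ p ^ suc (suc j) ∣ u (g * p ^ j)
    p^j+2∤ = proj₂ (period∧valuation j)
    index-≡ : g * p ^ j * p ≡ g * p ^ suc j
    index-≡ = trans (ℕ.*-assoc g (p ^ j) p) (cong (g *_) (ℕ.*-comm (p ^ j) p))
    modulus-∣ : p ^ suc (suc (suc j)) ∣ p * ((p * p ^ j) * (p * p ^ j))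
    modulus-∣ = ℕ.*-monoʳ-∣ p (p^[2+j]∣[p^[1+j]]² p j)

  valuation-bound : ∀ j n → p ^ suc j ∣ u (g * n) → p ^ j ∣ n
  valuation-bound zero n _ = ℕ.1∣ n
  valuation-bound (suc j) n p^j+2∣ with valuation-bound j n (ℕ.∣-trans (ℕ.n∣m*n p) p^j+2∣)
  ... | ℕ.divides n' refl with p ℕ.∣? n'
  ...   | yes p∣n' = ℕ.*-monoˡ-∣ (p ^ j) p∣n'
  ...   | no p∤n' = ⊥-elim (proj₂ (period∧valuation j)
                      (coprime-divisor (coprime-^ˡ (prime⇒coprime pp p∤n') (suc (suc j))) p^j+2∣n'*u))
    where
    index-≡ : g * (n' * p ^ j) ≡ g * p ^ j * n'
    index-≡ = trans (cong (g *_) (ℕ.*-comm n' (p ^ j))) (sym (ℕ.*-assoc g (p ^ j) n'))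
    p^j+2∣n'*u : p ^ suc (suc j) ∣ n' * u (g * p ^ j)
    p^j+2∣n'*u = ≡[mod]-∣ (u-*-≡ n' (proj₁ (period∧valuation j))) (p^[2+j]∣[p^[1+j]]² p j)
                          (subst (λ k → p ^ suc (suc j) ∣ u k) index-≡ p^j+2∣)

-- Periods modulo primes

module _ {a ℓ} (S : CommutativeSemiring a ℓ) where
  private
    module S = CommutativeSemiring S
  open import Algebra.Properties.Semiring.Exp S.semiring using (^-congʳ) renaming (_^_ to _^ˢ_)
  open import Algebra.Properties.Monoid.Mult S.+-monoid using (×-congˡ; ×-assocˡ; ×-homo-1) renaming (_×_ to _·_)
  open import Algebra.Properties.Monoid.Sum S.+-monoid using (sum; sum-init-last; sum-cong-≋; sum-replicate-zero)
  import Algebra.Properties.CommutativeSemiring.Binomial S as Binomial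
  open import Relation.Binary.Reasoning.Setoid S.setoid

  private
    sum-concentrated : ∀ {n} (t : Fin (suc n) → S.Carrier) →
                       (∀ i → t (inject₁ i) S.≈ S.0#) → sum t S.≈ t (fromℕ n)
    sum-concentrated {n} t zeros = begin
      sum t                              ≈⟨ sum-init-last t ⟩
      sum (t ∘ inject₁) S.+ t (fromℕ n)  ≈⟨ S.+-congʳ (S.trans (sum-cong-≋ zeros) (sum-replicate-zero n)) ⟩
      S.0# S.+ t (fromℕ n)               ≈⟨ S.+-identityˡ _ ⟩
      t (fromℕ n)                        ∎

  freshman's-dream : ∀ {q} → Prime q → (∀ x → q · x S.≈ S.0#) →
                     ∀ x y → (x S.+ y) ^ˢ q S.≈ x ^ˢ q S.+ y ^ˢ q
  freshman's-dream {suc q} pq char x y = begin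
    (x S.+ y) ^ˢ suc q
      ≈⟨ Binomial.theorem (suc q) x y ⟩
    term Fin.zero S.+ sum (term ∘ Fin.suc)
      ≈⟨ S.+-congˡ (sum-concentrated (term ∘ Fin.suc) middle-vanishes) ⟩
    term Fin.zero S.+ term (Fin.suc (fromℕ q))
      ≈⟨ S.+-cong first-term last-term ⟩
    y ^ˢ suc q S.+ x ^ˢ suc q
      ≈⟨ S.+-comm _ _ ⟩
    x ^ˢ suc q S.+ y ^ˢ suc q  ∎
    where
    term : Fin (suc (suc q)) → S.Carrier
    term = Binomial.binomialTerm x y (suc q)
    first-term : term Fin.zero S.≈ y ^ˢ suc q
    first-term = S.trans (S.+-identityʳ _) (S.*-identityˡ _)
    last-term : term (Fin.suc (fromℕ q)) S.≈ x ^ˢ suc q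
    last-term = top-term (cong suc (toℕ-fromℕ q))
      where
      top-term : ∀ {k} → k ≡ suc q → (suc q C k) · (x ^ˢ k S.* y ^ˢ (suc q ∸ k)) S.≈ x ^ˢ suc q
      top-term refl = begin
        (suc q C suc q) · (x ^ˢ suc q S.* y ^ˢ (q ∸ q))  ≈⟨ ×-congˡ (nCn≡1 (suc q)) ⟩
        1 · (x ^ˢ suc q S.* y ^ˢ (q ∸ q))                ≈⟨ ×-homo-1 _ ⟩
        x ^ˢ suc q S.* y ^ˢ (q ∸ q)                      ≈⟨ S.*-congˡ (^-congʳ y (ℕ.n∸n≡0 q)) ⟩
        x ^ˢ suc q S.* S.1#                              ≈⟨ S.*-identityʳ _ ⟩
        x ^ˢ suc q                                       ∎
    middle-vanishes : ∀ i → term (Fin.suc (inject₁ i)) S.≈ S.0#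
    middle-vanishes i
      with prime∣C pq (ℕ.s≤s ℕ.z≤n) (ℕ.s≤s (subst (_< q) (sym (toℕ-inject₁ i)) (toℕ<n i)))
    ... | ℕ.divides t C≡t*q = begin
      term (Fin.suc (inject₁ i))  ≡⟨ cong (_· b) (trans C≡t*q (ℕ.*-comm t (suc q))) ⟩
      (suc q * t) · b             ≈⟨ ×-assocˡ b (suc q) t ⟨
      suc q · (t · b)             ≈⟨ char (t · b) ⟩
      S.0#                        ∎
      where b : S.Carrier
            b = Binomial.binomial x y (suc q) (Fin.suc (inject₁ i))

module _ {q : ℕ} where
  private
    module Q = CommutativeSemiring (ℤφ/ ⌜ q ⌝)
  open import Algebra.Properties.Semiring.Exp Q.semiring using () renaming (_^_ to _^/_)
  open import Algebra.Properties.Monoid.Mult Q.+-monoid using () renaming (_×_ to _·/_)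

  private
    ^/≡^ᵩ : ∀ x n → x ^/ n ≡ x ^ᵩ n
    ^/≡^ᵩ x zero = refl
    ^/≡^ᵩ x (suc n) = cong (x ⊗_) (^/≡^ᵩ x n)

    ·/≡⌜⌝⊗ : ∀ n x → n ·/ x ≡ ⌜ n ⌝ ⊗ x
    ·/≡⌜⌝⊗ zero x = sym (R.zeroˡ x)
    ·/≡⌜⌝⊗ (suc n) x = trans (cong (x ⊕_) (·/≡⌜⌝⊗ n x)) (factor x ⌜ n ⌝)
      where factor : ∀ x N → x ⊕ N ⊗ x ≡ (𝟙 ⊕ N) ⊗ x
            factor = solve-∀ ℤφ-ring

  freshman's-dream-ℤφ : Prime q → ∀ x y → (x ⊕ y) ^ᵩ q ≈ x ^ᵩ q ⊕ y ^ᵩ q [mod ⌜ q ⌝ ]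
  freshman's-dream-ℤφ pq x y =
    subst₂ (_≈_[mod ⌜ q ⌝ ]) (^/≡^ᵩ (x ⊕ y) q) (cong₂ _⊕_ (^/≡^ᵩ x q) (^/≡^ᵩ y q))
      (freshman's-dream (ℤφ/ ⌜ q ⌝) pq q·w≈𝟘 x y)
    where
    q·w≈𝟘 : ∀ w → q ·/ w ≈ 𝟘 [mod ⌜ q ⌝ ]
    q·w≈𝟘 w = subst (_≈ 𝟘 [mod ⌜ q ⌝ ]) (sym (·/≡⌜⌝⊗ q w)) (∣ᵩ⇒≈𝟘 (∣ᵩ-⊗ʳ w ∣ᵩ-refl))

fermat : ∀ {q} → Prime q → ∀ a → ⌜ a ⌝ ^ᵩ q ≈ ⌜ a ⌝ [mod ⌜ q ⌝ ]
fermat {suc q} pq zero = ≈-reflexive (R.zeroˡ _)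
fermat {suc q} pq (suc a) = begin
  (𝟙 ⊕ ⌜ a ⌝) ^ᵩ suc q         ≈⟨ freshman's-dream-ℤφ pq 𝟙 ⌜ a ⌝ ⟩
  𝟙 ^ᵩ suc q ⊕ ⌜ a ⌝ ^ᵩ suc q  ≈⟨ ≈-⊕ (≈-reflexive (𝟙^ᵩ (suc q))) (fermat pq a) ⟩
  𝟙 ⊕ ⌜ a ⌝                    ∎
  where open ≈-Reasoning ⌜ suc q ⌝

-- Fermat gives q ∣ 5^q - 5 = 5 e (e + 2) with 5^r = e + 1.
euler-5 : ∀ r → let q = suc (2 * r) in
          Prime q → q ≢ 5 → (5 ^ r) ≡ 1 [mod q ] ⊎ (5 ^ r + 1) ≡ 0 [mod q ]
euler-5 r pq q≢5 = conclude (euclidsLemma 5 (e * (e + 2)) pq q∣5e[e+2])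
  where
  q e : ℕ
  q = suc (2 * r)
  e = ℕ.pred (5 ^ r)
  5^r≡1+e : 5 ^ r ≡ suc e
  5^r≡1+e = sym (ℕ.suc-pred (5 ^ r) {{ℕ.m^n≢0 5 r}})
  5^q≡5+5e[e+2] : 5 ^ q ≡ 5 + 5 * (e * (e + 2))
  5^q≡5+5e[e+2] = begin
    5 * 5 ^ (2 * r)        ≡⟨ cong (λ k → 5 * 5 ^ (r + k)) (ℕ.+-identityʳ r) ⟩
    5 * 5 ^ (r + r)        ≡⟨ cong (5 *_) (ℕ.^-distribˡ-+-* 5 r r) ⟩
    5 * (5 ^ r * 5 ^ r)    ≡⟨ cong (λ x → 5 * (x * x)) 5^r≡1+e ⟩
    5 * (suc e * suc e)    ≡⟨ expand e ⟩
    5 + 5 * (e * (e + 2))  ∎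
    where
    open ≡-Reasoning
    expand : ∀ e → 5 * (suc e * suc e) ≡ 5 + 5 * (e * (e + 2))
    expand = ℕSolver.solve-∀
  q∣5e[e+2] : q ∣ 5 * (e * (e + 2))
  q∣5e[e+2] = +≡[mod]⇒∣ {a = 5} (subst (_≡ 5 [mod q ]) 5^q≡5+5e[e+2]
                 (proj₁ (Equivalence.to ≈⇔≡[mod] 5^q≈5)))
    where
    5^q≈5 : ⌜ 5 ^ q ⌝ ≈ ⌜ 5 ⌝ [mod ⌜ q ⌝ ]
    5^q≈5 = subst (_≈ ⌜ 5 ⌝ [mod ⌜ q ⌝ ]) (sym (⌜⌝-^ 5 q)) (fermat pq 5)
  conclude : q ∣ 5 ⊎ q ∣ e * (e + 2) → (5 ^ r) ≡ 1 [mod q ] ⊎ (5 ^ r + 1) ≡ 0 [mod q ]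
  conclude (inj₁ q∣5) = ⊥-elim ([ prime≢1 pq , q≢5 ]′ (prime⇒irreducible (from-yes (prime? 5)) q∣5))
  conclude (inj₂ q∣e[e+2]) with euclidsLemma e (e + 2) pq q∣e[e+2]
  ... | inj₁ q∣e = inj₁ (subst (_≡ 1 [mod q ]) (sym 5^r≡1+e) (∣⇒+≡[mod] {a = 1} q∣e))
  ... | inj₂ q∣e+2 =
    inj₂ (subst (_≡ 0 [mod q ]) (trans (ℕ.+-suc e 1) (cong (_+ 1) (sym 5^r≡1+e))) (∣⇒+≡[mod] {a = 0} q∣e+2))

φ-unit : ∀ {z} → (φ ⊕ ⊖ 𝟙) ⊗ φ ≈ 𝟙 [mod z ]
φ-unit = ≈-reflexive refl

2-unit : ∀ r → ⌜ suc r ⌝ ⊗ ⌜ 2 ⌝ ≈ 𝟙 [mod ⌜ suc (2 * r) ⌝ ]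
2-unit r = begin
  ⌜ suc r ⌝ ⊗ ⌜ 2 ⌝  ≡⟨ ⌜⌝-* (suc r) 2 ⟨
  ⌜ suc r * 2 ⌝      ≡⟨ cong ⌜_⌝ ([1+r]*2≡2+2r r) ⟩
  𝟙 ⊕ ⌜ q ⌝          ≈⟨ ≈-drop ∣ᵩ-refl ⟩
  𝟙                  ∎
  where
  q : ℕ
  q = suc (2 * r)
  open ≈-Reasoning ⌜ q ⌝

-- 𝟙 ⊕ √5 and ⌜ 2 ⌝ ⊗ φ, and likewise √5 ⊗ √5 and ⌜ 5 ⌝, are equal by computation.
√5 : ℤφ
√5 = ⊖ 𝟙 ⊕ ⌜ 2 ⌝ ⊗ φ

frobenius-φ : ∀ r → let q = suc (2 * r) in
              Prime q → ⌜ 2 ⌝ ⊗ φ ^ᵩ q ≈ 𝟙 ⊕ √5 ⊗ ⌜ 5 ^ r ⌝ [mod ⌜ q ⌝ ]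
frobenius-φ r pq = begin
  ⌜ 2 ⌝ ⊗ φ ^ᵩ q               ≈⟨ ≈-⊗ (fermat pq 2) ≈-refl ⟨
  ⌜ 2 ⌝ ^ᵩ q ⊗ φ ^ᵩ q          ≡⟨ ^-distrib-* ⌜ 2 ⌝ φ q ⟨
  (𝟙 ⊕ √5) ^ᵩ q                ≈⟨ freshman's-dream-ℤφ pq 𝟙 √5 ⟩
  𝟙 ^ᵩ q ⊕ √5 ⊗ √5 ^ᵩ (2 * r)  ≡⟨ cong₂ _⊕_ (𝟙^ᵩ q) (cong (√5 ⊗_) (sym (^-assocʳ √5 2 r))) ⟩
  𝟙 ⊕ √5 ⊗ ⌜ 5 ⌝ ^ᵩ r          ≡⟨ cong (λ t → 𝟙 ⊕ √5 ⊗ t) (⌜⌝-^ 5 r) ⟨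
  𝟙 ⊕ √5 ⊗ ⌜ 5 ^ r ⌝           ∎
  where
  q : ℕ
  q = suc (2 * r)
  open ≈-Reasoning ⌜ q ⌝

period-odd-prime : ∀ r → let q = suc (2 * r) in
                   Prime q → q ≢ 5 → Period q (2 * r) ⊎ Period q (2 * suc q)
period-odd-prime r pq q≢5 = Sum.map period-if-5-residue period-if-5-nonresidue (euler-5 r pq q≢5)
  where
  q : ℕ
  q = suc (2 * r)
  open ≈-Reasoning ⌜ q ⌝
  period-if-5-residue : (5 ^ r) ≡ 1 [mod q ] → Period q (2 * r)
  period-if-5-residue 5^r≡1 = period
    (≈-cancel-unit {v = φ ⊕ ⊖ 𝟙} {w = φ} {x = φ ^ᵩ (2 * r)} {y = 𝟙} φ-unit
    (≈-cancel-unit {v = ⌜ suc r ⌝} {w = ⌜ 2 ⌝} {x = φ ^ᵩ q} {y = φ ⊗ 𝟙} (2-unit r) (begin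
      ⌜ 2 ⌝ ⊗ φ ^ᵩ q      ≈⟨ frobenius-φ r pq ⟩
      𝟙 ⊕ √5 ⊗ ⌜ 5 ^ r ⌝  ≈⟨ ≈-⊕ (≈-refl {x = 𝟙}) (≈-⊗ (≈-refl {x = √5}) 5^r≈𝟙) ⟩
      𝟙 ⊕ √5 ⊗ 𝟙          ≡⟨⟩
      ⌜ 2 ⌝ ⊗ (φ ⊗ 𝟙)     ∎)))
    where
    5^r≈𝟙 : ⌜ 5 ^ r ⌝ ≈ 𝟙 [mod ⌜ q ⌝ ]
    5^r≈𝟙 = Equivalence.from (≈⇔≡[mod] {q} {5 ^ r} {0} {1} {0}) (5^r≡1 , ≡[mod]-refl {0})
  period-if-5-nonresidue : (5 ^ r + 1) ≡ 0 [mod q ] → Period q (2 * suc q)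
  period-if-5-nonresidue 5^r+1≡0 = period (begin
    φ ^ᵩ (2 * suc q)      ≡⟨ cong (φ ^ᵩ_) (ℕ.*-comm 2 (suc q)) ⟩
    φ ^ᵩ (suc q * 2)      ≡⟨ ^-assocʳ φ (suc q) 2 ⟨
    (φ ⊗ φ ^ᵩ q) ^ᵩ 2     ≈⟨ ^ᵩ-≈ 2 (≈-⊗ (≈-refl {x = φ}) φ^q≈𝟙-φ) ⟩
    (φ ⊗ (𝟙 ⊕ ⊖ φ)) ^ᵩ 2  ≡⟨⟩
    𝟙                     ∎)
    where
    add-sub-𝟙 : ∀ x → x ≡ x ⊕ 𝟙 ⊕ ⊖ 𝟙
    add-sub-𝟙 = solve-∀ ℤφ-ring
    5^r+1≈𝟘 : ⌜ 5 ^ r + 1 ⌝ ≈ 𝟘 [mod ⌜ q ⌝ ]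
    5^r+1≈𝟘 = Equivalence.from (≈⇔≡[mod] {q} {5 ^ r + 1} {0} {0} {0}) (5^r+1≡0 , ≡[mod]-refl {0})
    5^r≈-𝟙 : ⌜ 5 ^ r ⌝ ≈ ⊖ 𝟙 [mod ⌜ q ⌝ ]
    5^r≈-𝟙 = begin
      ⌜ 5 ^ r ⌝
        ≡⟨ add-sub-𝟙 ⌜ 5 ^ r ⌝ ⟩
      ⌜ 5 ^ r ⌝ ⊕ 𝟙 ⊕ ⊖ 𝟙
        ≡⟨ cong (_⊕ ⊖ 𝟙) (⌜⌝-+ (5 ^ r) 1) ⟨
      ⌜ 5 ^ r + 1 ⌝ ⊕ ⊖ 𝟙
        ≈⟨ ≈-⊕ 5^r+1≈𝟘 (≈-refl {x = ⊖ 𝟙}) ⟩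
      𝟘 ⊕ ⊖ 𝟙
        ≡⟨⟩
      ⊖ 𝟙  ∎
    φ^q≈𝟙-φ : φ ^ᵩ q ≈ 𝟙 ⊕ ⊖ φ [mod ⌜ q ⌝ ]
    φ^q≈𝟙-φ = ≈-cancel-unit {v = ⌜ suc r ⌝} {w = ⌜ 2 ⌝} {x = φ ^ᵩ q} {y = 𝟙 ⊕ ⊖ φ} (2-unit r)
      (begin
      ⌜ 2 ⌝ ⊗ φ ^ᵩ q      ≈⟨ frobenius-φ r pq ⟩
      𝟙 ⊕ √5 ⊗ ⌜ 5 ^ r ⌝  ≈⟨ ≈-⊕ (≈-refl {x = 𝟙}) (≈-⊗ (≈-refl {x = √5}) 5^r≈-𝟙) ⟩
      𝟙 ⊕ √5 ⊗ ⊖ 𝟙        ≡⟨⟩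
      ⌜ 2 ⌝ ⊗ (𝟙 ⊕ ⊖ φ)   ∎)

period-5 : Period 5 20
period-5 = Equivalence.from (period⇔ {5} {20}) (ℕ.divides 1353 refl , ℕ.divides 2189 refl)

period-prime-coprime : ∀ {p q} → Prime p → Prime q → 3 ≤ q → q < p → ∃[ N ] Period q N × ¬ p ∣ N
period-prime-coprime {p} {q} pp pq 3≤q q<p with q ℕ.≟ 5 | odd-prime pq 3≤q
... | yes refl | _ =
  20 , period-5 , prime∤-* {m = 4} {5} pp (prime∤-< ℕ.z<s (ℕ.<-trans (ℕ.n<1+n 4) q<p)) (prime∤-< ℕ.z<s q<p)
... | no q≢5 | r , refl = Sum.[ (λ per → 2 * r , per , prime∤-< 0<2r (ℕ.<-trans (ℕ.n<1+n (2 * r)) q<p))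
                             , (λ per → 2 * suc q , per , prime∤-* pp (prime∤-< ℕ.z<s 2<p) p∤1+q) ]′
                             (period-odd-prime r pq q≢5)
  where
  2<p : 2 < p
  2<p = ℕ.<-trans (ℕ.<-≤-trans (ℕ.n<1+n 2) 3≤q) q<p
  0<2r : 0 < 2 * r
  0<2r = ℕ.≤-trans (ℕ.s≤s ℕ.z≤n) (ℕ.≤-pred 3≤q)
  p∤1+q : ¬ p ∣ suc q
  p∤1+q p∣1+q with ℕ.m≤n⇒m<n∨m≡n (ℕ.∣⇒≤ p∣1+q)
  ... | inj₁ p<1+q = ℕ.<⇒≱ q<p (ℕ.≤-pred p<1+q)
  ... | inj₂ p≡1+q =
    ℕ.<-irrefl (sym (even-prime pp (ℕ.divides (suc r) (trans p≡1+q (sym ([1+r]*2≡2+2r r)))))) 2<p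

period-coprime-to : ∀ {p} → Prime p → ∀ k → 0 < k → (∀ q → Prime q → q ∣ k → 3 ≤ q × q < p) →
                    ∃[ N ] Period k N × ¬ p ∣ N
period-coprime-to {p} pp = <-rec Goal step
  where
  Goal : ℕ → Set
  Goal k = 0 < k → (∀ q → Prime q → q ∣ k → 3 ≤ q × q < p) → ∃[ N ] Period k N × ¬ p ∣ N
  step : ∀ k → (∀ {j} → j < k → Goal j) → Goal k
  step k smaller 0<k small with 1 ℕ.<? k
  ... | no k≯1 = subst (λ k → ∃[ N ] Period k N × ¬ p ∣ N) (ℕ.≤-antisym 0<k (ℕ.≮⇒≥ k≯1))
                       (1 , period-1 1 , prime≢1 pp ∘ ℕ.∣1⇒≡1)
  ... | yes 1<k with prime-factor 1<k
  ...   | q , pq , ℕ.divides k' refl =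
    extend (q ℕ.∣? k') (smaller k'<k 0<k' (λ q' pq' q'∣k' → small q' pq' (ℕ.∣-trans q'∣k' (ℕ.m∣m*n q))))
    where
    0<k' : 0 < k'
    0<k' = ℕ.n≢0⇒n>0 λ { refl → ℕ.<-irrefl refl 0<k }
    k'<k : k' < k' * q
    k'<k = ℕ.m<m*n k' q {{ℕ.>-nonZero 0<k'}} (ℕ.nonTrivial⇒n>1 q {{prime⇒nonTrivial pq}})
    q-small : 3 ≤ q × q < p
    q-small = small q pq (ℕ.n∣m*n k')
    p∤q : ¬ p ∣ q
    p∤q = prime∤-< (ℕ.<-trans ℕ.z<s (ℕ.nonTrivial⇒n>1 q {{prime⇒nonTrivial pq}})) (proj₂ q-small)
    extend : Dec (q ∣ k') → ∃[ N ] Period k' N × ¬ p ∣ N → ∃[ N ] Period (k' * q) N × ¬ p ∣ N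
    extend (yes (ℕ.divides k'' refl)) (N , per , p∤N) =
      N * q
      , subst (λ M → Period M (N * q)) (square k'' q) (period-lift (subst (λ M → Period M N) (ℕ.*-comm k'' q) per))
              , prime∤-* pp p∤N p∤q
      where square : ∀ k q → q * (q * k) ≡ k * q * q
            square = ℕSolver.solve-∀
    extend (no q∤k') (N , per , p∤N) with period-prime-coprime pp pq (proj₁ q-small) (proj₂ q-small)
    ... | Nq , perq , p∤Nq =
      Nq * N , subst (λ M → Period M (Nq * N)) (ℕ.*-comm q k')
                   (period-coprime-* (prime⇒coprime pq q∤k') (period-*ʳ N perq) (period-*ˡ Nq per))
               , prime∤-* pp p∤Nq p∤N

period-quotient : ∀ r {e k l} → let p = suc (2 * r) in Prime p → (∀ g → IsGamma p g → ¬ p ^ 2 ∣ u g) →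
  ¬ p ∣ k → (∀ q → Prime q → q ∣ k → 3 ≤ q × q < p) →
  0 < l → Period (p ^ suc e * k) l → p ^ suc (suc e) ∣ u l →
  ∃[ h ] l ≡ p * h × Period (p ^ suc e * k) h
period-quotient r {e} {k} {l} pp no-wss p∤k k-small 0<l per p^[2+e]∣u[l] =
  h , l≡p*h , period-coprime-* {p ^ suc e} {k} {h} (coprime-^ˡ (prime⇒coprime pp p∤k) (suc e))
                                                    per-p^[1+e] per-k
  where
  p : ℕ
  p = suc (2 * r)
  per-p : Period p l
  per-p = period-∣ (ℕ.∣-trans (ℕ.m∣m*n (p ^ e)) (ℕ.m∣m*n k)) per
  γ-p : ∃[ g ] IsGamma p g
  γ-p = γ-exists 0<l per-p
  g : ℕ
  g = proj₁ γ-p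
  per-g : Period p g
  per-g = isPeriodIndex⇒period (proj₁ (proj₂ γ-p))
  p²∤u[g] : ¬ p ^ 2 ∣ u g
  p²∤u[g] = no-wss g (proj₂ γ-p)
  g∣l : g ∣ l
  g∣l = γ∣period (proj₂ γ-p) per-p
  n : ℕ
  n = ℕ._∣_.quotient g∣l
  p^[1+e]∣n : p ^ suc e ∣ n
  p^[1+e]∣n = valuation-bound r pp per-g p²∤u[g] (suc e) n
                (subst (λ i → p ^ suc (suc e) ∣ u i) (trans (ℕ._∣_.equality g∣l) (ℕ.*-comm n g)) p^[2+e]∣u[l])
  t : ℕ
  t = ℕ._∣_.quotient p^[1+e]∣n
  h : ℕ
  h = g * p ^ e * t
  l≡p*h : l ≡ p * h
  l≡p*h = trans (ℕ._∣_.equality g∣l)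
                (trans (cong (_* g) (ℕ._∣_.equality p^[1+e]∣n)) (regroup t p (p ^ e) g))
    where regroup : ∀ t p x g → t * (p * x) * g ≡ p * (g * x * t)
          regroup = ℕSolver.solve-∀
  per-p^[1+e] : Period (p ^ suc e) h
  per-p^[1+e] = period-*ʳ t (proj₁ (period∧valuation r pp per-g p²∤u[g] e))
  0<k : 0 < k
  0<k = ℕ.n≢0⇒n>0 λ { refl → p∤k (p ℕ.∣0) }
  per-k : Period k h
  per-k = period-coprime-cancel {k} {p} {proj₁ N-period} {h}
            (prime⇒coprime pp (proj₂ (proj₂ N-period))) (proj₁ (proj₂ N-period))
            (subst (Period k) l≡p*h (period-∣ {p ^ suc e * k} {k} {l} (ℕ.n∣m*n (p ^ suc e)) per))
    where N-period : ∃[ N ] Period k N × ¬ p ∣ N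
          N-period = period-coprime-to pp k 0<k k-small

γ-square∤u : ∀ r {e k l} → let p = suc (2 * r) in Prime p → (∀ g → IsGamma p g → ¬ p ^ 2 ∣ u g) →
  ¬ p ∣ k → (∀ q → Prime q → q ∣ k → 3 ≤ q × q < p) →
  IsGamma (p ^ suc e * k) l → ¬ (p ^ suc e * k) ^ 2 ∣ u l
γ-square∤u r {e} {k} {l} pp no-wss p∤k k-small ((0<l , l-index) , l-minimal) m²∣u[l] =
  ℕ.<⇒≱ h<l (l-minimal h (period⇒isPeriodIndex 0<h per-h))
  where
  p : ℕ
  p = suc (2 * r)
  quotient-period : ∃[ h ] l ≡ p * h × Period (p ^ suc e * k) h
  quotient-period = period-quotient r {e} {k} {l} pp no-wss p∤k k-small 0<l (isPeriodIndex⇒period (0<l , l-index))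
                                    (ℕ.∣-trans (p^[2+j]∣m² {p} {e} {p ^ suc e * k} (ℕ.m∣m*n k)) m²∣u[l])
  h : ℕ
  h = proj₁ quotient-period
  l≡p*h : l ≡ p * h
  l≡p*h = proj₁ (proj₂ quotient-period)
  per-h : Period (p ^ suc e * k) h
  per-h = proj₂ (proj₂ quotient-period)
  0<h : 0 < h
  0<h = ℕ.n≢0⇒n>0 λ h≡0 → ℕ.<-irrefl (sym (trans l≡p*h (trans (cong (p *_) h≡0) (ℕ.*-zeroʳ p)))) 0<l
  h<l : h < l
  h<l = subst (h <_) (trans (ℕ.*-comm h p) (sym l≡p*h))
              (ℕ.m<m*n h p {{ℕ.>-nonZero 0<h}} (ℕ.nonTrivial⇒n>1 p {{prime⇒nonTrivial pp}}))

lemma2p2 : (m : ℕ) → 1 < m →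
    (∀ p → Prime p → p ∣ m → 3 ≤ p) →
    (∀ p l → Prime p → IsGamma p l → ¬ (p ^ 2 ∣ u l)) →
    ∀ l → IsGamma m l → ¬ (m ^ 2 ∣ u l)
lemma2p2 m 1<m odd-factors no-wss l with largest-prime-factor 1<m
... | p , pp , p∣m , largest
  with odd-prime pp (odd-factors p pp p∣m) | p-adic-decomposition pp m (ℕ.<-trans ℕ.z<s 1<m)
... | r , refl | zero , k , m≡1*k , p∤k = ⊥-elim (p∤k (subst (p ∣_) (trans m≡1*k (ℕ.*-identityˡ k)) p∣m))
... | r , refl | suc e , k , refl , p∤k =
  γ-square∤u r {e} {k} {l} pp (λ g → no-wss p g pp) p∤k (λ q pq q∣k → odd-factors q pq (q∣m q∣k) , q<p pq q∣k)
  where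
  q∣m : ∀ {q} → q ∣ k → q ∣ p ^ suc e * k
  q∣m q∣k = ℕ.∣-trans q∣k (ℕ.n∣m*n (p ^ suc e))
  q<p : ∀ {q} → Prime q → q ∣ k → q < p
  q<p {q} pq q∣k = ℕ.≤∧≢⇒< (largest q pq (q∣m q∣k)) λ { refl → p∤k q∣k }
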